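{- A graph $G=([n],E)$ is a PEO graph if and only if, for every elimination forest $F$ for $G$, every vertex $j\in[n]$ has at most one child in $F$ that is smaller than $j$.
   Context: $G=([n],E)$ is a PEO graph if the ordering $1,2,\ldots,n$ is a perfect elimination ordering, i.e., for every vertex $v$, $v$ together with its neighbors smaller than $v$ forms a clique. An elimination tree for a connected graph $G$ is a rooted tree on its vertex set consisting of a root $x$ whose children are the roots of elimination trees for the connected components of $G-x$. An elimination forest for $G$ consists of one elimination tree for each connected component of $G$. -}

module Defs where

open import Data.Bool using (Bool; true; false)
open import Data.Nat using (ℕ)
open import Data.Fin using (Fin; _<_)
open import Data.Fin.Subset using (Subset; _∈_; _⊆_; _-_; ⊤; Nonempty)
open import Data.Maybe using (Maybe; just; nothing)
open import Data.Product using (Σ; _×_; ∃-syntax)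
open import Relation.Binary.PropositionalEquality using (_≡_; _≢_)

record Graph (n : ℕ) : Set where
  field
    adj     : Fin n → Fin n → Bool
    adj-sym : ∀ i j → adj i j ≡ adj j i
    irrefl  : ∀ i → adj i i ≡ false

open Graph public

Edge : ∀ {n} → Graph n → Fin n → Fin n → Set
Edge G i j = adj G i j ≡ true

IsPEO : ∀ {n} → Graph n → Set
IsPEO {n} G = ∀ (v u w : Fin n) → u < v → w < v → Edge G v u → Edge G v w →
              u ≢ w → Edge G u w

data Walk {n} (G : Graph n) (S : Subset n) : Fin n → Fin n → Set where
  here : ∀ {x} → x ∈ S → Walk G S x x
  step : ∀ {x y z} → x ∈ S → Edge G x y → Walk G S y z → Walk G S x z

Connected : ∀ {n} → Graph n → Subset n → Set
Connected G S = Nonempty S × (∀ {x y} → x ∈ S → y ∈ S → Walk G S x y)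

-- C is a connected component of G[S]: a nonempty connected subset of S
-- closed under G-adjacency inside S (i.e. maximal connected).
IsComponent : ∀ {n} → Graph n → Subset n → Subset n → Set
IsComponent G S C =
  C ⊆ S × Connected G C ×
  (∀ {x y} → x ∈ C → y ∈ S → Edge G x y → y ∈ C)

-- Rooted forests on Fin n are given by a parent map; `par v ≡ nothing` means v is a root.
ParentMap : ℕ → Set
ParentMap n = Fin n → Maybe (Fin n)

-- ElimTree G par S r : the subtree of `par` rooted at r, on vertex set S, is an
-- elimination tree for the connected graph G[S]: r is its root, and the children of r
-- are the roots of elimination trees for the connected components of G[S] - r.
data ElimTree {n} (G : Graph n) (par : ParentMap n) : Subset n → Fin n → Set where
  node : ∀ {S r} → Connected G S → r ∈ S →
         (∀ C → IsComponent G (S - r) C →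
            ∃[ c ] (c ∈ C × par c ≡ just r × ElimTree G par C c)) →
         ElimTree G par S r

IsElimForest : ∀ {n} → Graph n → ParentMap n → Set
IsElimForest G par =
  ∀ C → IsComponent G ⊤ C → ∃[ r ] (r ∈ C × par r ≡ nothing × ElimTree G par C r)

AtMostOneSmallerChild : ∀ {n} → ParentMap n → Fin n → Set
AtMostOneSmallerChild par j =
  ∀ c₁ c₂ → par c₁ ≡ just j → par c₂ ≡ just j → c₁ < j → c₂ < j → c₁ ≡ c₂

module Submission where

-- (⇒) Two children c₁, c₂ < j of j lie in different components C₁, C₂ of G[U] - j, where U is
-- the vertex set of the subtree rooted at j. A walk in G[U] from cᵢ to j, with its local
-- maxima shortcut by the PEO property, yields a neighbour bᵢ < j of j inside Cᵢ; then b₁, b₂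
-- are equal or adjacent, so C₁ = C₂.
-- (⇐) If v has non-adjacent smaller neighbours u and w, choose roots outside {u, v, w} for as
-- long as possible and then prefer v. The subtree containing u, v, w then has vertex set
-- exactly {u, v, w} and root v, so u and w are two smaller children of v.

open import Data.Bool using (true)
import Data.Bool as Bool
open import Data.Empty using (⊥; ⊥-elim)
open import Data.Fin using (Fin; _<_)
open import Data.Fin.Properties using (_≟_; <-cmp; <-irrefl; <-trans; any?)
open import Data.Fin.Subset using (Subset; _∈_; _∉_; _⊆_; _-_; _─_; _∪_; ⊤; ⁅_⁆; Nonempty; ∣_∣)
open import Data.Fin.Subset.Properties
  using (_∈?_; _⊂?_; ⊆-antisym; nonempty?; x∈⁅x⁆; x∈⁅y⁆⇒x≡y; ∣⁅x⁆∣≡1; ∣p∣≤n; p⊆q⇒∣p∣≤∣q∣;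
         p⊂q⇒∣p∣<∣q∣; x∈p⇒∣p-x∣<∣p∣; x∈p∧x≢y⇒x∈p-y; x∈p∧x∉q⇒x∈p─q; p─q⊆p; p⊆p∪q;
         q⊆p∪q; x∈p∪q⁻; ∈⊤)
open import Data.Maybe using (just; nothing)
open import Data.Maybe.Properties using (just-injective)
open import Data.Nat using (ℕ; zero; suc; _≤_; z≤n; s≤s; s≤s⁻¹)
import Data.Nat.Properties as ℕ
open import Data.Product using (_×_; _,_; proj₁; proj₂; ∃)
open import Data.Sum using (_⊎_; inj₁; inj₂; swap)
open import Data.Vec using (_∷_; there; tabulate)
open import Data.Vec.Properties using ([]=⇒lookup; lookup⇒[]=; lookup∘tabulate)
open import Function using (_∘_)
open import Function.Bundles using (_⇔_; mk⇔)
open import Relation.Binary.Definitions using (tri<; tri≈; tri>)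
open import Relation.Binary.PropositionalEquality using (_≡_; _≢_; refl; sym; trans; cong; subst; ≢-sym)
open import Relation.Nullary using (¬_; Dec; yes; no; does)
open import Relation.Nullary.Decidable using (dec-true; _×-dec_; _⊎-dec_)
open import Relation.Unary using (Pred; Decidable)
open import Defs

private
  variable
    n : ℕ
    x y : Fin n
    p q : Subset n

subset : ∀ {ℓ} {P : Pred (Fin n) ℓ} → Decidable P → Subset n
subset P? = tabulate (does ∘ P?)

∈-subset⁺ : ∀ {ℓ} {P : Pred (Fin n) ℓ} (P? : Decidable P) → P x → x ∈ subset P?
∈-subset⁺ {x = x} P? px =
  lookup⇒[]= x _ (trans (lookup∘tabulate (does ∘ P?) x) (dec-true (P? x) px))

∈-subset⁻ : ∀ {ℓ} {P : Pred (Fin n) ℓ} (P? : Decidable P) → x ∈ subset P? → P x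
∈-subset⁻ {x = x} P? x∈ with P? x | trans (sym (lookup∘tabulate (does ∘ P?) x)) ([]=⇒lookup x∈)
... | yes px | _ = px
... | no _   | ()

x∈p─q⇒x∉q : ∀ (p q : Subset n) → x ∈ p ─ q → x ∉ q
x∈p─q⇒x∉q (_ ∷ p) (_ ∷ q) (there x∈) (there x∈q) = x∈p─q⇒x∉q p q x∈ x∈q

x∈p-y⇒x≢y : x ∈ p - y → x ≢ y
x∈p-y⇒x≢y {p = p} x∈ refl = x∈p─q⇒x∉q p _ x∈ (x∈⁅x⁆ _)

x∈p-y⇒x∈p : x ∈ p - y → x ∈ p
x∈p-y⇒x∈p {p = p} = p─q⊆p p _

¬Nonempty[p─q]⇒p⊆q : ¬ Nonempty (p ─ q) → p ⊆ q
¬Nonempty[p─q]⇒p⊆q {q = q} empty {x} x∈p with x ∈? q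
... | yes x∈q = x∈q
... | no  x∉q = ⊥-elim (empty (x , x∈p∧x∉q⇒x∈p─q x∈p x∉q))

x∈p⇒∣p∣≰0 : x ∈ p → ¬ ∣ p ∣ ≤ 0
x∈p⇒∣p∣≰0 x∈p = ℕ.<⇒≱ (ℕ.≤-<-trans z≤n (x∈p⇒∣p-x∣<∣p∣ x∈p))

q⊆p-x⇒∣q∣≤k : ∀ {k} → x ∈ p → q ⊆ p - x → ∣ p ∣ ≤ suc k → ∣ q ∣ ≤ k
q⊆p-x⇒∣q∣≤k x∈p q⊆ ∣p∣≤1+k =
  s≤s⁻¹ (ℕ.<-≤-trans (ℕ.≤-<-trans (p⊆q⇒∣p∣≤∣q∣ q⊆) (x∈p⇒∣p-x∣<∣p∣ x∈p)) ∣p∣≤1+k)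

preferring : Subset n → Fin n → Subset n → Fin n
preferring X v S with nonempty? (S ─ X)
... | yes (x , _) = x
... | no _ with v ∈? S
...   | yes _ = v
...   | no _ with nonempty? S
...     | yes (x , _) = x
...     | no _ = v

preferring∈ : ∀ {X S : Subset n} {v} → x ∈ S → preferring X v S ∈ S
preferring∈ {X = X} {S} {v} x∈S with nonempty? (S ─ X)
... | yes (_ , y∈) = p─q⊆p S X y∈
... | no _ with v ∈? S
...   | yes v∈S = v∈S
...   | no _ with nonempty? S
...     | yes (_ , y∈S) = y∈S
...     | no empty = ⊥-elim (empty (_ , x∈S))

preferring-outside : ∀ {X S : Subset n} {v} → preferring X v S ∈ X → S ⊆ X
preferring-outside {X = X} {S} {v} r∈X with nonempty? (S ─ X)
... | yes (_ , y∈) = ⊥-elim (x∈p─q⇒x∉q S X y∈ r∈X)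
... | no empty = ¬Nonempty[p─q]⇒p⊆q empty

preferring-v : ∀ {X S : Subset n} {v} → v ∈ S → preferring X v S ∉ X ⊎ preferring X v S ≡ v
preferring-v {X = X} {S} {v} v∈S with nonempty? (S ─ X)
... | yes (_ , y∈) = inj₁ (x∈p─q⇒x∉q S X y∈)
... | no _ with v ∈? S
...   | yes _ = inj₂ refl
...   | no v∉S = ⊥-elim (v∉S v∈S)

module _ (G : Graph n) where

  Edge-sym : Edge G x y → Edge G y x
  Edge-sym {x = x} {y} e = trans (adj-sym G y x) e

  Edge-irrefl : ¬ Edge G x x
  Edge-irrefl {x = x} e with () ← trans (sym e) (irrefl G x)

  Edge? : ∀ x y → Dec (Edge G x y)
  Edge? x y = adj G x y Bool.≟ true

  private
    variable
      S T C K : Subset n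
      r j c₁ c₂ : Fin n

  source∈ : Walk G S x y → x ∈ S
  source∈ (here x∈S)     = x∈S
  source∈ (step x∈S _ _) = x∈S

  target∈ : Walk G S x y → y ∈ S
  target∈ (here y∈S)   = y∈S
  target∈ (step _ _ w) = target∈ w

  walk-⊆ : S ⊆ T → Walk G S x y → Walk G T x y
  walk-⊆ S⊆T (here x∈S)     = here (S⊆T x∈S)
  walk-⊆ S⊆T (step x∈S e w) = step (S⊆T x∈S) e (walk-⊆ S⊆T w)

  _++ʷ_ : ∀ {z} → Walk G S x y → Walk G S y z → Walk G S x z
  here _       ++ʷ w′ = w′
  step x∈S e w ++ʷ w′ = step x∈S e (w ++ʷ w′)

  _∷ʳʷ_ : ∀ {z} → Walk G S x y → Edge G y z × z ∈ S → Walk G S x z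
  w ∷ʳʷ (e , z∈S) = w ++ʷ step (target∈ w) e (here z∈S)

  reverseʷ : Walk G S x y → Walk G S y x
  reverseʷ (here x∈S)     = here x∈S
  reverseʷ (step x∈S e w) = reverseʷ w ∷ʳʷ (Edge-sym e , x∈S)

  Closed : Subset n → Subset n → Set
  Closed T C = ∀ {x y} → x ∈ C → y ∈ T → Edge G x y → y ∈ C

  walk-stays : S ⊆ T → Closed T C → x ∈ C → Walk G S x y → y ∈ C
  walk-stays S⊆T closed x∈C (here _)     = x∈C
  walk-stays S⊆T closed x∈C (step _ e w) =
    walk-stays S⊆T closed (closed x∈C (S⊆T (source∈ w)) e) w

  -- The component of x in G[T] is computed as the n-th neighbourhood ball of x in G[T]:
  -- balls stop growing after at most n steps, so that one is closed.
  Attached : Subset n → Subset n → Pred (Fin n) _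
  Attached T A y = y ∈ T × ∃ λ z → z ∈ A × Edge G z y

  attached? : ∀ T A → Decidable (Attached T A)
  attached? T A y = (y ∈? T) ×-dec any? (λ z → (z ∈? A) ×-dec Edge? z y)

  grow : Subset n → Subset n → Subset n
  grow T A = A ∪ subset (attached? T A)

  ⊆-grow : ∀ {A} → A ⊆ grow T A
  ⊆-grow {A = A} = p⊆p∪q _

  ∈-grow⁻ : ∀ {A} → y ∈ grow T A → y ∈ A ⊎ Attached T A y
  ∈-grow⁻ {T = T} {A = A} y∈ with x∈p∪q⁻ A _ y∈
  ... | inj₁ y∈A = inj₁ y∈A
  ... | inj₂ y∈N = inj₂ (∈-subset⁻ (attached? T A) y∈N)

  ∈-grow⁺ : ∀ {A z} → z ∈ A → y ∈ T → Edge G z y → y ∈ grow T A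
  ∈-grow⁺ {T = T} {A = A} z∈A y∈T e = q⊆p∪q A _ (∈-subset⁺ (attached? T A) (y∈T , _ , z∈A , e))

  ball : Subset n → Fin n → ℕ → Subset n
  ball T x zero    = ⁅ x ⁆
  ball T x (suc k) = grow T (ball T x k)

  x∈ball : ∀ k → x ∈ ball T x k
  x∈ball zero    = x∈⁅x⁆ _
  x∈ball (suc k) = ⊆-grow (x∈ball k)

  ball⊆closed : x ∈ C → Closed T C → ∀ k → ball T x k ⊆ C
  ball⊆closed x∈C closed zero y∈ rewrite x∈⁅y⁆⇒x≡y _ y∈ = x∈C
  ball⊆closed x∈C closed (suc k) y∈ with ∈-grow⁻ y∈
  ... | inj₁ y∈B               = ball⊆closed x∈C closed k y∈B
  ... | inj₂ (y∈T , _ , z∈B , e) = closed (ball⊆closed x∈C closed k z∈B) y∈T e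

  ball⊆ : x ∈ T → ∀ k → ball T x k ⊆ T
  ball⊆ x∈T zero y∈ rewrite x∈⁅y⁆⇒x≡y _ y∈ = x∈T
  ball⊆ x∈T (suc k) y∈ with ∈-grow⁻ y∈
  ... | inj₁ y∈B           = ball⊆ x∈T k y∈B
  ... | inj₂ (y∈T , _)     = y∈T

  ball-walk : ∀ k → y ∈ ball T x k → Walk G (ball T x k) x y
  ball-walk zero y∈ rewrite x∈⁅y⁆⇒x≡y _ y∈ = here (x∈⁅x⁆ _)
  ball-walk (suc k) y∈ with ∈-grow⁻ y∈
  ... | inj₁ y∈B               = walk-⊆ ⊆-grow (ball-walk k y∈B)
  ... | inj₂ (_ , _ , z∈B , e) = walk-⊆ ⊆-grow (ball-walk k z∈B) ∷ʳʷ (e , y∈)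

  Stable : Subset n → Fin n → ℕ → Set
  Stable T x k = grow T (ball T x k) ⊆ ball T x k

  stable-suc : ∀ k → Stable T x k → Stable T x (suc k)
  stable-suc {T = T} {x} k stable =
    subst (λ B → grow T B ⊆ B) (sym (⊆-antisym stable ⊆-grow)) stable

  stable⊎grown : ∀ k → Stable T x k ⊎ suc k ≤ ∣ ball T x k ∣
  stable⊎grown {x = x} zero = inj₂ (ℕ.≤-reflexive (sym (∣⁅x⁆∣≡1 x)))
  stable⊎grown {T = T} {x} (suc k) with stable⊎grown {T = T} {x} k
  ... | inj₁ stable = inj₁ (stable-suc k stable)
  ... | inj₂ grown with ball T x k ⊂? grow T (ball T x k)
  ...   | yes strict = inj₂ (ℕ.≤-trans (s≤s grown) (p⊂q⇒∣p∣<∣q∣ strict))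
  ...   | no ¬strict = inj₁ (stable-suc k λ {y} y∈ → stays y y∈)
    where
    stays : ∀ y → y ∈ grow T (ball T x k) → y ∈ ball T x k
    stays y y∈ with y ∈? ball T x k
    ... | yes y∈B = y∈B
    ... | no  y∉B = ⊥-elim (¬strict (⊆-grow , y , y∈ , y∉B))

  component : Subset n → Fin n → Subset n
  component T x = ball T x n

  x∈component : x ∈ component T x
  x∈component = x∈ball n

  component-closed : Closed T (component T x)
  component-closed {T = T} {x} y∈ z∈T e with stable⊎grown {T = T} {x} n
  ... | inj₁ stable = stable (∈-grow⁺ y∈ z∈T e)
  ... | inj₂ grown  = ⊥-elim (ℕ.<-irrefl refl (ℕ.<-≤-trans grown (∣p∣≤n (ball T x n))))

  component-isComponent : x ∈ T → IsComponent G T (component T x)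
  component-isComponent x∈T =
    ball⊆ x∈T n ,
    ((_ , x∈component) , λ y∈ z∈ → reverseʷ (ball-walk n y∈) ++ʷ ball-walk n z∈) ,
    component-closed

  component-unique : IsComponent G T C → x ∈ C → component T x ≡ C
  component-unique (C⊆T , (_ , walk) , closed) x∈C =
    ⊆-antisym (ball⊆closed x∈C closed n)
              (λ y∈C → walk-stays C⊆T component-closed x∈component (walk x∈C y∈C))

  component-walk : IsComponent G T C → x ∈ C → y ∈ C → Walk G C x y
  component-walk (_ , (_ , walk) , _) = walk

  components-≡ : IsComponent G T C → IsComponent G T K → x ∈ C → x ∈ K → C ≡ K
  components-≡ isC isK x∈C x∈K = trans (sym (component-unique isC x∈C)) (component-unique isK x∈K)

  removed∉component : IsComponent G (S - r) K → r ∉ K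
  removed∉component (K⊆ , _) r∈K = x∈p-y⇒x≢y (K⊆ r∈K) refl

  parent∈ : ∀ {par} → ElimTree G par S r → x ∈ S → x ≢ r → par x ≡ just y → y ∈ S
  parent∈ {S = S} {r} {x} (node _ r∈S children) x∈S x≢r px
    with children (component (S - r) x) (component-isComponent (x∈p∧x≢y⇒x∈p-y x∈S x≢r))
  ... | c , _ , pc , T with x ≟ c
  ...   | yes refl rewrite just-injective (trans (sym px) pc) = r∈S
  ...   | no  x≢c  = x∈p-y⇒x∈p (ball⊆ (x∈p∧x≢y⇒x∈p-y x∈S x≢r) n (parent∈ T x∈component x≢c px))

  parent-in-subtree : ∀ {par c x} → ElimTree G par K c → par c ≡ just r → x ∈ K → par x ≡ just j →
                      (x ≡ c × j ≡ r) ⊎ (x ≢ c × j ∈ K)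
  parent-in-subtree {c = c} {x} T pc x∈K px with x ≟ c
  ... | yes refl = inj₁ (refl , just-injective (trans (sym px) pc))
  ... | no  x≢c  = inj₂ (x≢c , parent∈ T x∈K x≢c px)

  ElimTree-cong : ∀ {par par′} → ElimTree G par S r →
                  (∀ {x} → x ∈ S → x ≢ r → par x ≡ par′ x) → ElimTree G par′ S r
  ElimTree-cong {par′ = par′} (node conn r∈S children) agree = node conn r∈S children′
    where
    children′ : ∀ C → IsComponent G (_ - _) C → ∃ λ c → c ∈ C × par′ c ≡ just _ × ElimTree G par′ C c
    children′ C isC@(C⊆ , _) with children C isC
    ... | c , c∈C , pc , T =
      c , c∈C , trans (sym (agree (x∈p-y⇒x∈p (C⊆ c∈C)) (x∈p-y⇒x≢y (C⊆ c∈C)))) pc ,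
      ElimTree-cong T (λ x∈C _ → agree (x∈p-y⇒x∈p (C⊆ x∈C)) (x∈p-y⇒x≢y (C⊆ x∈C)))

  record Separates (j c₁ c₂ : Fin n) : Set where
    constructor separates
    field
      {U C₁ C₂}    : Subset n
      connected    : Connected G U
      j∈U          : j ∈ U
      C₁-component : IsComponent G (U - j) C₁
      C₂-component : IsComponent G (U - j) C₂
      c₁∈C₁        : c₁ ∈ C₁
      c₂∈C₂        : c₂ ∈ C₂
      C₁≢C₂        : C₁ ≢ C₂

  siblings-separated : ∀ {par} → ElimTree G par S r → c₁ ∈ S → c₂ ∈ S → c₁ ≢ r → c₂ ≢ r →
                       par c₁ ≡ just j → par c₂ ≡ just j → c₁ ≢ c₂ → Separates j c₁ c₂
  siblings-separated {S = S} {r} {c₁} {c₂} (node conn r∈S children) c₁∈S c₂∈S c₁≢r c₂≢r p₁ p₂ c₁≢c₂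
    with component-isComponent (x∈p∧x≢y⇒x∈p-y c₁∈S c₁≢r)
  ... | isK₁ with children (component (S - r) c₁) isK₁ | c₂ ∈? component (S - r) c₁
  ...   | a , _ , pa , T₁ | yes c₂∈K₁
    with parent-in-subtree T₁ pa x∈component p₁ | parent-in-subtree T₁ pa c₂∈K₁ p₂
  ...     | inj₁ (refl , _) | inj₁ (refl , _) = ⊥-elim (c₁≢c₂ refl)
  ...     | inj₁ (_ , refl) | inj₂ (_ , r∈K₁) = ⊥-elim (removed∉component isK₁ r∈K₁)
  ...     | inj₂ (_ , r∈K₁) | inj₁ (_ , refl) = ⊥-elim (removed∉component isK₁ r∈K₁)
  ...     | inj₂ (c₁≢a , _) | inj₂ (c₂≢a , _) =
    siblings-separated T₁ x∈component c₂∈K₁ c₁≢a c₂≢a p₁ p₂ c₁≢c₂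
  siblings-separated {S = S} {r} {c₁} {c₂} (node conn r∈S children) c₁∈S c₂∈S c₁≢r c₂≢r p₁ p₂ c₁≢c₂
      | isK₁ | a , _ , pa , T₁ | no c₂∉K₁
    with component-isComponent (x∈p∧x≢y⇒x∈p-y c₂∈S c₂≢r)
  ... | isK₂ with children (component (S - r) c₂) isK₂
  ...   | b , _ , pb , T₂
    with parent-in-subtree T₁ pa x∈component p₁ | parent-in-subtree T₂ pb x∈component p₂
  ...     | inj₁ (_ , refl) | inj₁ _ =
    separates conn r∈S isK₁ isK₂ x∈component x∈component λ K₁≡K₂ →
      c₂∉K₁ (subst (c₂ ∈_) (sym K₁≡K₂) x∈component)
  ...     | inj₁ (_ , refl) | inj₂ (_ , r∈K₂) = ⊥-elim (removed∉component isK₂ r∈K₂)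
  ...     | inj₂ (_ , r∈K₁) | inj₁ (_ , refl) = ⊥-elim (removed∉component isK₁ r∈K₁)
  ...     | inj₂ (_ , j∈K₁) | inj₂ (_ , j∈K₂) =
    ⊥-elim (c₂∉K₁ (subst (c₂ ∈_) (components-≡ isK₂ isK₁ j∈K₂ j∈K₁) x∈component))

  has-parent⇒≢root : ∀ {par : ParentMap n} → par x ≡ just j → par r ≡ nothing → x ≢ r
  has-parent⇒≢root px pr refl with () ← trans (sym px) pr

  forest-siblings-separated : ∀ {par} → IsElimForest G par → par c₁ ≡ just j → par c₂ ≡ just j →
                              c₁ ≢ c₂ → Separates j c₁ c₂
  forest-siblings-separated {c₁ = c₁} {j = j} {c₂ = c₂} forest p₁ p₂ c₁≢c₂
    with forest (component ⊤ c₁) (component-isComponent ∈⊤) | c₂ ∈? component ⊤ c₁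
  ... | r , _ , pr , T | yes c₂∈K =
    siblings-separated T x∈component c₂∈K (has-parent⇒≢root p₁ pr) (has-parent⇒≢root p₂ pr) p₁ p₂ c₁≢c₂
  ... | r , _ , pr , T | no c₂∉K
    with forest (component ⊤ c₂) (component-isComponent ∈⊤)
  ...   | r₂ , _ , pr₂ , T₂ =
    ⊥-elim (c₂∉K (subst (c₂ ∈_) (components-≡ isK₂ isK₁ j∈K₂ j∈K₁) x∈component))
    where
    j∈K₁ : j ∈ component ⊤ c₁
    j∈K₁ = parent∈ T x∈component (has-parent⇒≢root p₁ pr) p₁
    j∈K₂ : j ∈ component ⊤ c₂
    j∈K₂ = parent∈ T₂ x∈component (has-parent⇒≢root p₂ pr₂) p₂
    isK₁ : IsComponent G ⊤ (component ⊤ c₁)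
    isK₁ = component-isComponent ∈⊤
    isK₂ : IsComponent G ⊤ (component ⊤ c₂)
    isK₂ = component-isComponent ∈⊤

  data Ascent (j b : Fin n) : Fin n → Set where
    []     : Ascent j b b
    ascend : ∀ {p a} → Ascent j b p → p < a → Edge G p a → j < a → Ascent j b a

  ascent-top≢ : ∀ {b a} → b < j → Ascent j b a → a ≢ j
  ascent-top≢ b<j []                  refl = <-irrefl refl b<j
  ascent-top≢ b<j (ascend _ _ _ j<a) refl = <-irrefl refl j<a

  module _ (peo : IsPEO G) where

    -- Both ascent lemmas shortcut the top vertex a: its smaller neighbours are adjacent.
    ascent-close : ∀ {b a} → b < j → Ascent j b a → Edge G a j → Edge G b j
    ascent-close b<j []                      bj = bj
    ascent-close b<j (ascend asc p<a pa j<a) aj =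
      ascent-close b<j asc (peo _ _ _ p<a j<a (Edge-sym pa) aj (ascent-top≢ b<j asc))

    ascent-extend : ∀ {b a a′} → b < j → Ascent j b a → Edge G a a′ → j < a′ → Ascent j b a′
    ascent-extend b<j [] e j<a′ = ascend [] (<-trans b<j j<a′) e j<a′
    ascent-extend {a′ = a′} b<j (ascend {p} {a} asc p<a pa j<a) e j<a′ with <-cmp a a′
    ... | tri< a<a′ _ _ = ascend (ascend asc p<a pa j<a) a<a′ e j<a′
    ... | tri≈ _ refl _ = ⊥-elim (Edge-irrefl e)
    ... | tri> _ _ a′<a with p ≟ a′
    ...   | yes refl = asc
    ...   | no  p≢a′ = ascent-extend b<j asc (peo a p a′ p<a a′<a (Edge-sym pa) e p≢a′) j<a′

    -- Walk from c to j, keeping an ascending path from the last vertex b < j seen so far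
    -- to the current vertex; on arrival at j, shortcutting that path makes b adjacent to j.
    smaller-neighbour : ∀ {c} → IsComponent G (S - j) C → c ∈ C → c < j → Walk G S c j →
                        ∃ λ b → b ∈ C × b < j × Edge G b j
    smaller-neighbour {S = S} {j} {C} (C⊆ , _ , closed) c∈C c<j = follow c∈C c<j [] c∈C
      where
      follow : ∀ {b a} → b ∈ C → b < j → Ascent j b a → a ∈ C → Walk G S a j →
               ∃ λ b → b ∈ C × b < j × Edge G b j
      follow b∈C b<j asc a∈C (here _) = ⊥-elim (x∈p-y⇒x≢y (C⊆ a∈C) refl)
      follow b∈C b<j asc a∈C (step {y = y} _ e w) with y ≟ j
      ... | yes refl = _ , b∈C , b<j , ascent-close b<j asc e
      ... | no  y≢j with closed a∈C (x∈p∧x≢y⇒x∈p-y (source∈ w) y≢j) e | <-cmp y j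
      ...   | y∈C | tri< y<j _ _ = follow y∈C y<j [] y∈C w
      ...   | _   | tri≈ _ y≡j _ = ⊥-elim (y≢j y≡j)
      ...   | y∈C | tri> _ _ j<y = follow b∈C b<j (ascent-extend b<j asc e j<y) y∈C w

    smaller-components-≡ : ∀ {C₁ C₂} → Connected G S → j ∈ S →
                           IsComponent G (S - j) C₁ → IsComponent G (S - j) C₂ →
                           c₁ ∈ C₁ → c₂ ∈ C₂ → c₁ < j → c₂ < j → C₁ ≡ C₂
    smaller-components-≡ (_ , walk) j∈S isC₁@(C₁⊆ , _ , closed₁) isC₂@(C₂⊆ , _) c₁∈C₁ c₂∈C₂ c₁<j c₂<j
      with smaller-neighbour isC₁ c₁∈C₁ c₁<j (walk (x∈p-y⇒x∈p (C₁⊆ c₁∈C₁)) j∈S)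
         | smaller-neighbour isC₂ c₂∈C₂ c₂<j (walk (x∈p-y⇒x∈p (C₂⊆ c₂∈C₂)) j∈S)
    ... | b₁ , b₁∈C₁ , b₁<j , b₁j | b₂ , b₂∈C₂ , b₂<j , b₂j with b₁ ≟ b₂
    ...   | yes refl = components-≡ isC₁ isC₂ b₁∈C₁ b₂∈C₂
    ...   | no b₁≢b₂ =
      components-≡ isC₁ isC₂
        (closed₁ b₁∈C₁ (C₂⊆ b₂∈C₂) (peo _ _ _ b₁<j b₂<j (Edge-sym b₁j) (Edge-sym b₂j) b₁≢b₂)) b₂∈C₂

    separates⇒¬both< : Separates j c₁ c₂ → c₁ < j → c₂ < j → ⊥
    separates⇒¬both< (separates conn j∈U isC₁ isC₂ c₁∈C₁ c₂∈C₂ C₁≢C₂) c₁<j c₂<j =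
      C₁≢C₂ (smaller-components-≡ conn j∈U isC₁ isC₂ c₁∈C₁ c₂∈C₂ c₁<j c₂<j)

  peo⇒atMostOneSmallerChild : IsPEO G → ∀ par → IsElimForest G par → ∀ j → AtMostOneSmallerChild par j
  peo⇒atMostOneSmallerChild peo par forest j c₁ c₂ p₁ p₂ c₁<j c₂<j with c₁ ≟ c₂
  ... | yes c₁≡c₂ = c₁≡c₂
  ... | no  c₁≢c₂ =
    ⊥-elim (separates⇒¬both< peo (forest-siblings-separated forest p₁ p₂ c₁≢c₂) c₁<j c₂<j)

  module ChosenForest (choose : Subset n → Fin n) (choose∈ : ∀ {S x} → x ∈ S → choose S ∈ S) where

    -- The elimination tree of G[S] rooted at choose S, provided the fuel satisfies ∣ S ∣ ≤ k.
    treeParent : ℕ → Subset n → ParentMap n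
    treeParent zero    S x = nothing
    treeParent (suc k) S x with x ∈? S - choose S
    ... | no  _ = nothing
    ... | yes _ with x ≟ choose (component (S - choose S) x)
    ...   | yes _ = just (choose S)
    ...   | no  _ = treeParent k (component (S - choose S) x) x

    forestParent : ParentMap n
    forestParent x with x ≟ choose (component ⊤ x)
    ... | yes _ = nothing
    ... | no  _ = treeParent n (component ⊤ x) x

    treeParent-subroot : ∀ {k} → IsComponent G (S - choose S) K → x ∈ K → x ≡ choose K →
                      treeParent (suc k) S x ≡ just (choose S)
    treeParent-subroot {S = S} {x = x} isK@(K⊆ , _) x∈K x≡r with component-unique isK x∈K
    ... | refl with x ∈? S - choose S
    ...   | no x∉ = ⊥-elim (x∉ (K⊆ x∈K))
    ...   | yes _ with x ≟ choose (component (S - choose S) x)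
    ...     | yes _   = refl
    ...     | no  x≢r = ⊥-elim (x≢r x≡r)

    treeParent-descend : ∀ {k} → IsComponent G (S - choose S) K → x ∈ K → x ≢ choose K →
                         treeParent (suc k) S x ≡ treeParent k K x
    treeParent-descend {S = S} {x = x} isK@(K⊆ , _) x∈K x≢r with component-unique isK x∈K
    ... | refl with x ∈? S - choose S
    ...   | no x∉ = ⊥-elim (x∉ (K⊆ x∈K))
    ...   | yes _ with x ≟ choose (component (S - choose S) x)
    ...     | yes x≡r = ⊥-elim (x≢r x≡r)
    ...     | no  _   = refl

    forestParent-root : IsComponent G ⊤ K → x ∈ K → x ≡ choose K → forestParent x ≡ nothing
    forestParent-root {x = x} isK x∈K x≡r with component-unique isK x∈K
    ... | refl with x ≟ choose (component ⊤ x)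
    ...   | yes _   = refl
    ...   | no  x≢r = ⊥-elim (x≢r x≡r)

    forestParent-descend : IsComponent G ⊤ K → x ∈ K → x ≢ choose K → forestParent x ≡ treeParent n K x
    forestParent-descend {x = x} isK x∈K x≢r with component-unique isK x∈K
    ... | refl with x ≟ choose (component ⊤ x)
    ...   | yes x≡r = ⊥-elim (x≢r x≡r)
    ...   | no  _   = refl

    treeParent-elimTree : ∀ k → Connected G S → ∣ S ∣ ≤ k → ElimTree G (treeParent k S) S (choose S)
    treeParent-elimTree zero    ((_ , x∈S) , _) ∣S∣≤0 = ⊥-elim (x∈p⇒∣p∣≰0 x∈S ∣S∣≤0)
    treeParent-elimTree {S = S} (suc k) conn@((_ , x∈S) , _) ∣S∣≤1+k = node conn (choose∈ x∈S) children
      where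
      children : ∀ C → IsComponent G (S - choose S) C →
                 ∃ λ c → c ∈ C × treeParent (suc k) S c ≡ just (choose S) ×
                         ElimTree G (treeParent (suc k) S) C c
      children C isC@(C⊆ , connC@((_ , y∈C) , _) , _) =
        choose C , choose∈ y∈C , treeParent-subroot isC (choose∈ y∈C) refl ,
        ElimTree-cong (treeParent-elimTree k connC (q⊆p-x⇒∣q∣≤k (choose∈ x∈S) C⊆ ∣S∣≤1+k))
                      (λ z∈C z≢r → sym (treeParent-descend isC z∈C z≢r))

    forestParent-elimForest : IsElimForest G forestParent
    forestParent-elimForest C isC@(_ , connC@((_ , y∈C) , _) , _) =
      choose C , choose∈ y∈C , forestParent-root isC (choose∈ y∈C) refl ,
      ElimTree-cong (treeParent-elimTree n connC (∣p∣≤n C))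
                    (λ z∈C z≢r → sym (forestParent-descend isC z∈C z≢r))

  walk-within-nonadjacent-pair : ∀ {a b} → (∀ {x} → x ∈ K → x ≡ a ⊎ x ≡ b) → ¬ Edge G a b →
                             Walk G K a x → x ≡ a
  walk-within-nonadjacent-pair K⊆ab ¬ab (here _) = refl
  walk-within-nonadjacent-pair K⊆ab ¬ab (step _ e w) with K⊆ab (source∈ w)
  ... | inj₁ refl = ⊥-elim (Edge-irrefl e)
  ... | inj₂ refl = ⊥-elim (¬ab e)

  module NonPEOWitness {u v w : Fin n} (vu : Edge G v u) (vw : Edge G v w) (¬uw : ¬ Edge G u w) where

    Among : Pred (Fin n) _
    Among x = x ≡ u ⊎ x ≡ v ⊎ x ≡ w

    among? : Decidable Among
    among? x = x ≟ u ⊎-dec x ≟ v ⊎-dec x ≟ w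

    triple : Subset n
    triple = subset among?

    choose : Subset n → Fin n
    choose = preferring triple v

    open ChosenForest choose preferring∈ public

    u≢v : u ≢ v
    u≢v refl = Edge-irrefl vu

    w≢v : w ≢ v
    w≢v refl = Edge-irrefl vw

    choose≢u,w : v ∈ S → choose S ≢ u × choose S ≢ w
    choose≢u,w v∈S with preferring-v {X = triple} v∈S
    ... | inj₁ r∉triple = (λ r≡u → r∉triple (∈-subset⁺ among? (inj₁ r≡u)))
                        , (λ r≡w → r∉triple (∈-subset⁺ among? (inj₂ (inj₂ r≡w))))
    ... | inj₂ r≡v      = (λ r≡u → u≢v (trans (sym r≡u) r≡v))
                        , (λ r≡w → w≢v (trans (sym r≡w) r≡v))

    v,w∈component : u ∈ T → v ∈ T → w ∈ T → v ∈ component T u × w ∈ component T u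
    v,w∈component {T = T} u∈T v∈T w∈T = v∈K , component-closed v∈K w∈T vw
      where
      v∈K : v ∈ component T u
      v∈K = component-closed x∈component v∈T (Edge-sym vu)

    transfer-u,w : ∀ {par par′ : ParentMap n} → v ∈ K → u ∈ K → w ∈ K →
                   (∀ {x} → x ∈ K → x ≢ choose K → par x ≡ par′ x) →
                   par′ u ≡ just v × par′ w ≡ just v → par u ≡ just v × par w ≡ just v
    transfer-u,w v∈K u∈K w∈K agree (pu , pw) with choose≢u,w v∈K
    ... | r≢u , r≢w = trans (agree u∈K (≢-sym r≢u)) pu , trans (agree w∈K (≢-sym r≢w)) pw

    treeParent[u,w]≡v : ∀ k → ∣ S ∣ ≤ k → u ∈ S → v ∈ S → w ∈ S →
                        treeParent k S u ≡ just v × treeParent k S w ≡ just v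
    treeParent[u,w]≡v zero ∣S∣≤0 u∈S _ _ = ⊥-elim (x∈p⇒∣p∣≰0 u∈S ∣S∣≤0)
    treeParent[u,w]≡v {S = S} (suc k) ∣S∣≤1+k u∈S v∈S w∈S with preferring-v {X = triple} v∈S
    ... | inj₁ r∉triple =
      transfer-u,w v∈K x∈component w∈K (treeParent-descend isK)
        (treeParent[u,w]≡v k (q⊆p-x⇒∣q∣≤k (preferring∈ u∈S) (proj₁ isK) ∣S∣≤1+k) x∈component v∈K w∈K)
      where
      remains : ∀ {x} → Among x → x ∈ S → x ∈ S - choose S
      remains among x∈S =
        x∈p∧x≢y⇒x∈p-y x∈S (λ x≡r → r∉triple (subst (_∈ triple) x≡r (∈-subset⁺ among? among)))
      u∈S-r : u ∈ S - choose S
      u∈S-r = remains (inj₁ refl) u∈S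
      isK : IsComponent G (S - choose S) (component (S - choose S) u)
      isK = component-isComponent u∈S-r
      v,w∈K : v ∈ component (S - choose S) u × w ∈ component (S - choose S) u
      v,w∈K = v,w∈component u∈S-r (remains (inj₂ (inj₁ refl)) v∈S) (remains (inj₂ (inj₂ refl)) w∈S)
      v∈K : v ∈ component (S - choose S) u
      v∈K = proj₁ v,w∈K
      w∈K : w ∈ component (S - choose S) u
      w∈K = proj₂ v,w∈K
    ... | inj₂ r≡v =
      leaf u∈S u≢v u-or-w ¬uw , leaf w∈S w≢v (λ x∈S x≢v → swap (u-or-w x∈S x≢v)) (¬uw ∘ Edge-sym)
      where
      S⊆triple : S ⊆ triple
      S⊆triple =
        preferring-outside (subst (_∈ triple) (sym r≡v) (∈-subset⁺ among? (inj₂ (inj₁ refl))))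
      u-or-w : ∀ {x} → x ∈ S → x ≢ v → x ≡ u ⊎ x ≡ w
      u-or-w x∈S x≢v with ∈-subset⁻ among? (S⊆triple x∈S)
      ... | inj₁ x≡u        = inj₁ x≡u
      ... | inj₂ (inj₁ x≡v) = ⊥-elim (x≢v x≡v)
      ... | inj₂ (inj₂ x≡w) = inj₂ x≡w
      leaf : ∀ {a b} → a ∈ S → a ≢ v → (∀ {x} → x ∈ S → x ≢ v → x ≡ a ⊎ x ≡ b) → ¬ Edge G a b →
             treeParent (suc k) S a ≡ just v
      leaf {a} {b} a∈S a≢v ab ¬ab = trans (treeParent-subroot isK x∈component (sym r≡a)) (cong just r≡v)
        where
        isK : IsComponent G (S - choose S) (component (S - choose S) a)
        isK = component-isComponent (x∈p∧x≢y⇒x∈p-y a∈S (λ a≡r → a≢v (trans a≡r r≡v)))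
        K⊆ab : ∀ {x} → x ∈ component (S - choose S) a → x ≡ a ⊎ x ≡ b
        K⊆ab x∈K = ab (x∈p-y⇒x∈p (proj₁ isK x∈K))
                      (λ x≡v → x∈p-y⇒x≢y (proj₁ isK x∈K) (trans x≡v (sym r≡v)))
        r≡a : choose (component (S - choose S) a) ≡ a
        r≡a = walk-within-nonadjacent-pair K⊆ab ¬ab
                (component-walk isK x∈component (preferring∈ x∈component))

    forestParent[u,w]≡v : forestParent u ≡ just v × forestParent w ≡ just v
    forestParent[u,w]≡v with v,w∈component {T = ⊤} ∈⊤ ∈⊤ ∈⊤
    ... | v∈K , w∈K =
      transfer-u,w v∈K x∈component w∈K (forestParent-descend (component-isComponent ∈⊤))
        (treeParent[u,w]≡v n (∣p∣≤n (component ⊤ u)) x∈component v∈K w∈K)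

  atMostOneSmallerChild⇒peo : (∀ par → IsElimForest G par → ∀ j → AtMostOneSmallerChild par j) → IsPEO G
  atMostOneSmallerChild⇒peo atMostOne v u w u<v w<v vu vw u≢w with Edge? u w
  ... | yes uw  = uw
  ... | no  ¬uw =
    ⊥-elim (u≢w (atMostOne forestParent forestParent-elimForest v u w
                           (proj₁ forestParent[u,w]≡v) (proj₂ forestParent[u,w]≡v) u<v w<v))
    where open NonPEOWitness vu vw ¬uw

lemma16 : (n : ℕ) (G : Graph n) →
    IsPEO G ⇔ (∀ (par : ParentMap n) → IsElimForest G par →
                 ∀ (j : Fin n) → AtMostOneSmallerChild par j)
lemma16 n G = mk⇔ (peo⇒atMostOneSmallerChild G) (atMostOneSmallerChild⇒peo G)
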